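{- Let $f:\{0,1\}^n\to\{0,1\}$ be given by a compact form DNF representation of size $d_\vee$ with the block property. Then $\mathrm{bs}_0(f)=d_\vee$.
   Context: For $x\in\{0,1\}^n$ and $B\subseteq[n]$, $x^B$ flips the bits of $x$ in $B$. $\mathrm{bs}(f,x)$ is the maximum $k$ such that there are pairwise disjoint $B_1,\dots,B_k\subseteq[n]$ with $f(x^{B_j})\ne f(x)$ for all $j$; $\mathrm{bs}_0(f)=\max_{f(x)=0}\mathrm{bs}(f,x)$. A DNF representation is an OR of $d_\vee$ terms $\wedge_1,\dots,\wedge_{d_\vee}$ ($d_\vee$ is its size), each an AND of literals with no term containing a variable and its negation; $A_i$ (resp. $\overline{A}_i$) is the set of variables appearing unnegated (resp. negated) in $\wedge_i$; $S_i$ is the set of assignments satisfying $\wedge_i$. Compact form: (a) $f(0^n)=0$, (b) $\mathrm{bs}_0(f)=\mathrm{bs}(f,0^n)$, (c) $S_i\setminus\bigcup_{j\ne i}S_j\neq\emptyset$ for all $i$. Block property: $A_i\cap A_j=\emptyset$ for all $i\ne j$. -}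

module Defs where

open import Data.Nat using (ℕ; _≤_)
open import Data.Fin using (Fin)
open import Data.Bool using (Bool; true; false; _xor_; _∧_; if_then_else_; not)
open import Data.Maybe using (Maybe; just; nothing)
open import Data.List using (allFin)
open import Data.Bool.ListAction using (all; any)
open import Data.Product using (Σ; _×_; ∃; _,_)
open import Relation.Binary.PropositionalEquality using (_≡_; _≢_)
open import Relation.Nullary using (¬_)

Assignment : ℕ → Set
Assignment n = Fin n → Bool

Subset : ℕ → Set
Subset n = Fin n → Bool

flip : ∀ {n} → Assignment n → Subset n → Assignment n
flip x B v = x v xor B v

zeros : ∀ {n} → Assignment n
zeros _ = false

BoolFun : ℕ → Set
BoolFun n = Assignment n → Bool

SensitiveBlocks : ∀ {n} → BoolFun n → Assignment n → (k : ℕ) → (Fin k → Subset n) → Set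
SensitiveBlocks f x k B =
  (∀ i j → i ≢ j → ∀ v → ¬ (B i v ≡ true × B j v ≡ true))
  × (∀ j → f (flip x (B j)) ≢ f x)

HasBlocks : ∀ {n} → BoolFun n → Assignment n → ℕ → Set
HasBlocks {n} f x k = Σ (Fin k → Subset n) (SensitiveBlocks f x k)

IsBs : ∀ {n} → BoolFun n → Assignment n → ℕ → Set
IsBs f x k = HasBlocks f x k × (∀ m → HasBlocks f x m → m ≤ k)

IsBs0 : ∀ {n} → BoolFun n → ℕ → Set
IsBs0 f k = (∃ λ x → f x ≡ false × IsBs f x k)
          × (∀ x m → f x ≡ false → IsBs f x m → m ≤ k)

-- A term (AND of literals) over n variables: for each variable,
-- nothing = absent, just true = unnegated (in A_i), just false = negated (in Ā_i).
-- This encoding forbids a term containing a variable and its negation.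
Term : ℕ → Set
Term n = Fin n → Maybe Bool

DNF : ℕ → ℕ → Set
DNF n d = Fin d → Term n

litSat : Maybe Bool → Bool → Bool
litSat nothing  _ = true
litSat (just b) c = if b then c else not c

satTerm : ∀ {n} → Term n → Assignment n → Bool
satTerm {n} t x = all (λ v → litSat (t v) (x v)) (allFin n)

evalDNF : ∀ {n d} → DNF n d → BoolFun n
evalDNF {n} {d} T x = any (λ i → satTerm (T i) x) (allFin d)

CompactForm : ∀ {n d} → DNF n d → Set
CompactForm {n} {d} T =
  (evalDNF T zeros ≡ false)
  × (∀ k → (IsBs0 (evalDNF T) k → IsBs (evalDNF T) zeros k)
         × (IsBs (evalDNF T) zeros k → IsBs0 (evalDNF T) k))
  × (∀ i → ∃ λ x → satTerm (T i) x ≡ true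
                  × (∀ j → j ≢ i → satTerm (T j) x ≡ false))

BlockProperty : ∀ {n d} → DNF n d → Set
BlockProperty T = ∀ i j → i ≢ j → ∀ v → ¬ (T i v ≡ just true × T j v ≡ just true)

-- A sensitive block of the DNF at 0ⁿ must satisfy some term, and it must contain all positive
-- variables of that term. Two disjoint blocks therefore cannot satisfy the same term unless the
-- term has no positive variables, in which case 0ⁿ itself satisfies it, contradicting f(0ⁿ) = 0.
-- So block ↦ term is injective and bs(f,0ⁿ) ≤ d_∨. Conversely the sets A_i of positive variables
-- are sensitive blocks (flipping A_i satisfies the i-th term), disjoint by the block property.
-- Compactness (b) turns bs(f,0ⁿ) = d_∨ into bs₀(f) = d_∨.
module Submission where

open import Defs
open import Data.Nat using (ℕ; _≤_)
open import Data.Fin using (Fin; _≟_)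
open import Data.Fin.Properties using (injective⇒≤)
open import Data.Bool using (Bool; true; false)
open import Data.Bool.Properties using (T-≡; ¬-not)
open import Data.Bool.ListAction using (all; any)
open import Data.Maybe using (Maybe; just; nothing)
open import Data.List using (allFin)
import Data.List.Relation.Unary.All.Properties as All
import Data.List.Relation.Unary.Any.Properties as Any
open import Data.Product using (∃; _×_; _,_; proj₁; proj₂; map₂)
open import Function using (_∘_; Equivalence)
open import Relation.Binary.PropositionalEquality using (_≡_; _≢_; refl; sym; trans; subst)
open import Relation.Nullary using (¬_; yes; no; contradiction)

open Equivalence using (to; from)

true≢false : true ≢ false
true≢false ()

all-allFin⁺ : ∀ {n} (p : Fin n → Bool) → (∀ v → p v ≡ true) → all p (allFin n) ≡ true
all-allFin⁺ p h = to T-≡ (All.all⁻ p (All.tabulate⁺ (from T-≡ ∘ h)))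

all-allFin⁻ : ∀ {n} (p : Fin n → Bool) → all p (allFin n) ≡ true → ∀ v → p v ≡ true
all-allFin⁻ {n} p h = to T-≡ ∘ All.tabulate⁻ (All.all⁺ p (allFin n) (from T-≡ h))

any-allFin⁺ : ∀ {n} (p : Fin n → Bool) i → p i ≡ true → any p (allFin n) ≡ true
any-allFin⁺ p i h = to T-≡ (Any.any⁺ p (Any.tabulate⁺ i (from T-≡ h)))

any-allFin⁻ : ∀ {n} (p : Fin n → Bool) → any p (allFin n) ≡ true → ∃ λ i → p i ≡ true
any-allFin⁻ {n} p h = map₂ (to T-≡) (Any.tabulate⁻ (Any.any⁻ p (allFin n) (from T-≡ h)))

satTerm⁺ : ∀ {n} (t : Term n) x → (∀ v → litSat (t v) (x v) ≡ true) → satTerm t x ≡ true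
satTerm⁺ t x = all-allFin⁺ (λ v → litSat (t v) (x v))

satTerm⁻ : ∀ {n} (t : Term n) x → satTerm t x ≡ true → ∀ v → litSat (t v) (x v) ≡ true
satTerm⁻ t x = all-allFin⁻ (λ v → litSat (t v) (x v))

evalDNF⁺ : ∀ {n d} (T : DNF n d) x i → satTerm (T i) x ≡ true → evalDNF T x ≡ true
evalDNF⁺ T x = any-allFin⁺ (λ i → satTerm (T i) x)

evalDNF⁻ : ∀ {n d} (T : DNF n d) x → evalDNF T x ≡ true → ∃ λ i → satTerm (T i) x ≡ true
evalDNF⁻ T x = any-allFin⁻ (λ i → satTerm (T i) x)

isPositive : Maybe Bool → Bool
isPositive (just true) = true
isPositive _           = false

isPositive⇒≡just-true : ∀ m → isPositive m ≡ true → m ≡ just true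
isPositive⇒≡just-true (just true) _ = refl

litSat-isPositive : ∀ m → litSat m (isPositive m) ≡ true
litSat-isPositive nothing      = refl
litSat-isPositive (just true)  = refl
litSat-isPositive (just false) = refl

litSat-false : ∀ m → m ≢ just true → litSat m false ≡ true
litSat-false nothing      _  = refl
litSat-false (just true)  ¬p = contradiction refl ¬p
litSat-false (just false) _  = refl

positives : ∀ {n} → Term n → Subset n
positives t = isPositive ∘ t

Disjoint : ∀ {n} → Subset n → Subset n → Set
Disjoint B C = ∀ v → ¬ (B v ≡ true × C v ≡ true)

satTerm-flip-positives : ∀ {n} (t : Term n) → satTerm t (flip zeros (positives t)) ≡ true
satTerm-flip-positives t = satTerm⁺ t _ (litSat-isPositive ∘ t)

satTerm-zeros : ∀ {n} (t : Term n) → (∀ v → t v ≢ just true) → satTerm t zeros ≡ true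
satTerm-zeros t noPositive = satTerm⁺ t zeros (λ v → litSat-false (t v) (noPositive v))

-- A positive literal x_v is satisfied after flipping B from 0ⁿ only if v ∈ B.
satTerm-zeros-of-disjoint-flips : ∀ {n} (t : Term n) {B C : Subset n} → Disjoint B C →
  satTerm t (flip zeros B) ≡ true → satTerm t (flip zeros C) ≡ true → satTerm t zeros ≡ true
satTerm-zeros-of-disjoint-flips t {B} {C} disjoint satB satC = satTerm-zeros t noPositive
  where
  noPositive : ∀ v → t v ≢ just true
  noPositive v tv≡+ = disjoint v
    ( subst (λ m → litSat m (B v) ≡ true) tv≡+ (satTerm⁻ t _ satB v)
    , subst (λ m → litSat m (C v) ≡ true) tv≡+ (satTerm⁻ t _ satC v))

module _ {n d : ℕ} (T : DNF n d) (f0≡0 : evalDNF T zeros ≡ false) where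

  blocks-at-zeros-≤-size : ∀ m → HasBlocks (evalDNF T) zeros m → m ≤ d
  blocks-at-zeros-≤-size m (C , disjoint , sensitive) = injective⇒≤ {f = termOf} termOf-injective
    where
    flipSatisfiesTerm : ∀ k → ∃ λ i → satTerm (T i) (flip zeros (C k)) ≡ true
    flipSatisfiesTerm k = evalDNF⁻ T _ (¬-not (λ fk≡0 → sensitive k (trans fk≡0 (sym f0≡0))))

    termOf : Fin m → Fin d
    termOf = proj₁ ∘ flipSatisfiesTerm

    termOf-injective : ∀ {k l} → termOf k ≡ termOf l → k ≡ l
    termOf-injective {k} {l} same with k ≟ l
    ... | yes k≡l = k≡l
    ... | no  k≢l = contradiction (trans (sym f0≡1) f0≡0) true≢false
      where
      satL : satTerm (T (termOf k)) (flip zeros (C l)) ≡ true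
      satL = subst (λ i → satTerm (T i) (flip zeros (C l)) ≡ true) (sym same)
                   (proj₂ (flipSatisfiesTerm l))
      f0≡1 : evalDNF T zeros ≡ true
      f0≡1 = evalDNF⁺ T zeros (termOf k)
        (satTerm-zeros-of-disjoint-flips (T (termOf k)) (disjoint k l k≢l)
                                          (proj₂ (flipSatisfiesTerm k)) satL)

  positives-sensitiveBlocks : BlockProperty T → SensitiveBlocks (evalDNF T) zeros d (positives ∘ T)
  positives-sensitiveBlocks blockProperty = disjoint , sensitive
    where
    disjoint : ∀ i j → i ≢ j → Disjoint (positives (T i)) (positives (T j))
    disjoint i j i≢j v (vi , vj) = blockProperty i j i≢j v
      (isPositive⇒≡just-true (T i v) vi , isPositive⇒≡just-true (T j v) vj)

    sensitive : ∀ i → evalDNF T (flip zeros (positives (T i))) ≢ evalDNF T zeros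
    sensitive i fi≡f0 = true≢false
      (trans (sym (evalDNF⁺ T _ i (satTerm-flip-positives (T i)))) (trans fi≡f0 f0≡0))

  bs-zeros≡size : BlockProperty T → IsBs (evalDNF T) zeros d
  bs-zeros≡size blockProperty =
    (positives ∘ T , positives-sensitiveBlocks blockProperty) , blocks-at-zeros-≤-size

lemma4 : ∀ (n d : ℕ) (T : DNF n d) → CompactForm T → BlockProperty T → IsBs0 (evalDNF T) d
lemma4 n d T (f0≡0 , bs₀≡bs-zeros , _) blockProperty =
  proj₂ (bs₀≡bs-zeros d) (bs-zeros≡size T f0≡0 blockProperty)
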